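{- Let $(X,\mathcal{B})$ be a segregated $(n,k,p,2;j)$-lottery design with exactly $r$ isolated blocks. Then \[r\ge\left\lceil\frac{2n-jk}{k}\right\rceil.\]
   Context: An $(n,k,p,t;j)$-lottery design is a $k$-uniform hypergraph $(X,\mathcal{B})$ (all blocks of size $k$, $n\ge k\ge t\ge2$) with $|X|=n$, $|\mathcal{B}|=j$, such that every $D\subseteq X$ with $|D|=p$ satisfies $|B\cap D|\ge t$ for some $B\in\mathcal{B}$. The degree of a vertex is the number of blocks containing it. A block is isolated if it is disjoint from every other block; the design is segregated if no vertex has degree $0$ and every vertex of degree $1$ lies in an isolated block. -}

module Defs where

open import Data.Nat using (ℕ; zero; suc; _≤_)
open import Data.Integer using (ℤ; -_)
open import Data.Integer.DivMod using (_/ℕ_)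
open import Data.Fin using (Fin)
open import Data.Fin.Subset using (Subset; _∈_; _∉_; _∩_; ∣_∣)
open import Data.Vec using (tabulate; lookup)
open import Data.Product using (Σ; ∃; _×_)
open import Relation.Binary.PropositionalEquality using (_≡_; _≢_)
open import Function.Definitions using (Injective)

-- Ceiling of the rational a / k for an integer a and natural k ≥ 1
-- (k = 0 is a junk case, returns 0; never used since k ≥ t ≥ 2).
⌈_/_⌉ : ℤ → ℕ → ℤ
⌈ a / zero ⌉ = ℤ.pos 0
⌈ a / suc k ⌉ = - ((- a) /ℕ suc k)

-- A hypergraph on vertex set Fin n with j blocks, indexed by Fin j.
-- Blocks are pairwise distinct (B is a set of j blocks).
Blocks : ℕ → ℕ → Set
Blocks n j = Fin j → Subset n

IsKUniform : ∀ {n j} → ℕ → Blocks n j → Set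
IsKUniform k B = ∀ b → ∣ B b ∣ ≡ k

IsLotteryDesign : (n k p t j : ℕ) → Blocks n j → Set
IsLotteryDesign n k p t j B =
  (k ≤ n) × (t ≤ k) × (2 ≤ t) ×
  Injective _≡_ _≡_ B ×
  IsKUniform k B ×
  (∀ (D : Subset n) → ∣ D ∣ ≡ p → ∃ λ b → t ≤ ∣ B b ∩ D ∣)

degree : ∀ {n j} → Blocks n j → Fin n → ℕ
degree B x = ∣ tabulate (λ b → lookup (B b) x) ∣

Isolated : ∀ {n j} → Blocks n j → Fin j → Set
Isolated B b = ∀ b' → b' ≢ b → ∀ x → x ∈ B b → x ∉ B b'

Segregated : ∀ {n j} → Blocks n j → Set
Segregated B =
  (∀ x → degree B x ≢ 0) ×
  (∀ x → degree B x ≡ 1 → ∃ λ b → x ∈ B b × Isolated B b)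

NumIsolated : ∀ {n j} → Blocks n j → ℕ → Set
NumIsolated {j = j} B r =
  Σ (Subset j) λ S → (∣ S ∣ ≡ r) × (∀ b → (b ∈ S → Isolated B b) × (Isolated B b → b ∈ S))

-- Count vertex–block incidences twice.  Summed over the vertices, the degrees
-- give jk, and the number of isolated blocks through each vertex gives rk.  In a
-- segregated design every vertex either has degree at least 2 or lies in an
-- isolated block, so degree plus isolated-degree is at least 2 at every vertex;
-- hence 2n ≤ jk + rk, i.e. r ≥ (2n − jk)/k, and r is an integer.
module Submission where

open import Data.Bool using (Bool; true; false)
open import Data.Empty using (⊥-elim)
open import Data.Fin using (Fin; zero; suc)
open import Data.Fin.Subset using (Subset; _∈_; ∣_∣)
open import Data.Nat using (ℕ; zero; suc; _+_; _*_; _≤_; z≤n; s≤s; NonZero)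
open import Data.Nat.Properties
  using (+-*-semiring; +-mono-≤; ≤-trans; ≤-reflexive; m≤m+n; m≤n+m; *-identityˡ; *-identityʳ; *-comm; +-identityʳ; module ≤-Reasoning)
open import Data.Product using (_,_; proj₂)
open import Data.Vec using ([]; _∷_; lookup; tabulate)
open import Data.Vec.Properties using (lookup∘tabulate; []=⇒lookup)
open import Relation.Binary.PropositionalEquality using (_≡_; refl; sym; trans; cong; cong₂; module ≡-Reasoning)
open import Algebra.Properties.Semiring.Sum +-*-semiring
  using (sum; sum-syntax; sum-cong-≗; ∑-comm; ∑-distrib-+; *-distribˡ-sum; *-distribʳ-sum)

open import Defs

𝟙 : Bool → ℕ
𝟙 true  = 1
𝟙 false = 0

∑-const : ∀ n c → ∑[ i < n ] c ≡ n * c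
∑-const zero    c = refl
∑-const (suc n) c = cong (c +_) (∑-const n c)

∑-mono-≤ : ∀ {n} {f g : Fin n → ℕ} → (∀ i → f i ≤ g i) → sum f ≤ sum g
∑-mono-≤ {zero}  f≤g = z≤n
∑-mono-≤ {suc n} f≤g = +-mono-≤ (f≤g zero) (∑-mono-≤ (λ i → f≤g (suc i)))

term≤∑ : ∀ {n} (f : Fin n → ℕ) i → f i ≤ sum f
term≤∑ f zero    = m≤m+n (f zero) _
term≤∑ f (suc i) = ≤-trans (term≤∑ (λ i → f (suc i)) i) (m≤n+m _ (f zero))

∣p∣≡∑𝟙 : ∀ {n} (p : Subset n) → ∣ p ∣ ≡ ∑[ i < n ] 𝟙 (lookup p i)
∣p∣≡∑𝟙 []          = refl
∣p∣≡∑𝟙 (true ∷ p)  = cong suc (∣p∣≡∑𝟙 p)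
∣p∣≡∑𝟙 (false ∷ p) = ∣p∣≡∑𝟙 p

module _ {n j : ℕ} (B : Blocks n j) where

  incidence : Fin j → Fin n → ℕ
  incidence b x = 𝟙 (lookup (B b) x)

  weightedDegree : (Fin j → ℕ) → Fin n → ℕ
  weightedDegree w x = ∑[ b < j ] (w b * incidence b x)

  degree≡weightedDegree-1 : ∀ x → degree B x ≡ weightedDegree (λ _ → 1) x
  degree≡weightedDegree-1 x = trans (∣p∣≡∑𝟙 (tabulate (λ b → lookup (B b) x)))
    (sum-cong-≗ λ b → trans (cong 𝟙 (lookup∘tabulate (λ b → lookup (B b) x) b)) (sym (*-identityˡ _)))

  ∑-weightedDegree : ∀ {k} → IsKUniform k B → (w : Fin j → ℕ) →
    ∑[ x < n ] weightedDegree w x ≡ (∑[ b < j ] w b) * k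
  ∑-weightedDegree {k} uniform w = begin
    ∑[ x < n ] ∑[ b < j ] (w b * incidence b x)  ≡⟨ ∑-comm (λ x b → w b * incidence b x) ⟩
    ∑[ b < j ] ∑[ x < n ] (w b * incidence b x)  ≡⟨ sum-cong-≗ (λ b → sym (*-distribˡ-sum (w b) (incidence b))) ⟩
    ∑[ b < j ] (w b * ∑[ x < n ] incidence b x) ≡⟨ sum-cong-≗ (λ b → cong (w b *_) blockSize) ⟩
    ∑[ b < j ] (w b * k)                        ≡⟨ sym (*-distribʳ-sum k w) ⟩
    (∑[ b < j ] w b) * k                        ∎
    where
    open ≡-Reasoning
    blockSize : ∀ {b} → ∑[ x < n ] incidence b x ≡ k
    blockSize {b} = trans (sym (∣p∣≡∑𝟙 (B b))) (uniform b)

  isolatedDegree : Subset j → Fin n → ℕ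
  isolatedDegree S = weightedDegree (λ b → 𝟙 (lookup S b))

  1≤isolatedDegree : ∀ {S b x} → b ∈ S → x ∈ B b → 1 ≤ isolatedDegree S x
  1≤isolatedDegree {S} {b} {x} b∈S x∈Bb = ≤-trans one≤term (term≤∑ (λ b → 𝟙 (lookup S b) * incidence b x) b)
    where
    one≤term : 1 ≤ 𝟙 (lookup S b) * incidence b x
    one≤term = ≤-reflexive (sym (cong₂ (λ s t → 𝟙 s * 𝟙 t) ([]=⇒lookup b∈S) ([]=⇒lookup x∈Bb)))

  2≤degree+isolatedDegree : Segregated B → ∀ {S} → (∀ b → Isolated B b → b ∈ S) →
    ∀ x → 2 ≤ degree B x + isolatedDegree S x
  2≤degree+isolatedDegree (degree≢0 , degree1⇒isolated) isolated⇒∈S x with degree B x in eq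
  ... | zero        = ⊥-elim (degree≢0 x eq)
  ... | suc (suc _) = s≤s (s≤s z≤n)
  ... | suc zero    with degree1⇒isolated x eq
  ...   | b , x∈Bb , isolated = s≤s (1≤isolatedDegree (isolated⇒∈S b isolated) x∈Bb)

  2n≤jk+rk : ∀ {k r} → IsKUniform k B → Segregated B → NumIsolated B r → 2 * n ≤ j * k + r * k
  2n≤jk+rk {k} {r} uniform segregated (S , ∣S∣≡r , isolated⇔∈S) = begin
    2 * n                                          ≡⟨ trans (*-comm 2 n) (sym (∑-const n 2)) ⟩
    ∑[ x < n ] 2                                   ≤⟨ ∑-mono-≤ (2≤degree+isolatedDegree segregated λ b → proj₂ (isolated⇔∈S b)) ⟩
    ∑[ x < n ] (degree B x + isolatedDegree S x)   ≡⟨ sum-cong-≗ (λ x → cong (_+ isolatedDegree S x) (degree≡weightedDegree-1 x)) ⟩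
    ∑[ x < n ] (weightedDegree (λ _ → 1) x + isolatedDegree S x)
      ≡⟨ ∑-distrib-+ (weightedDegree (λ _ → 1)) (isolatedDegree S) ⟩
    ∑[ x < n ] weightedDegree (λ _ → 1) x + ∑[ x < n ] isolatedDegree S x
      ≡⟨ cong₂ _+_ (∑-weightedDegree uniform (λ _ → 1)) (∑-weightedDegree uniform (λ b → 𝟙 (lookup S b))) ⟩
    (∑[ b < j ] 1) * k + (∑[ b < j ] 𝟙 (lookup S b)) * k
      ≡⟨ cong₂ (λ a c → a * k + c * k) (trans (∑-const j 1) (*-identityʳ j)) (trans (sym (∣p∣≡∑𝟙 S)) ∣S∣≡r) ⟩
    j * k + r * k                                  ∎
    where open ≤-Reasoning

open import Data.Integer as ℤ using (+_; -_; _-_; _⊖_; _≥_)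
import Data.Integer.Properties as ℤ
open import Data.Integer.DivMod using (_/ℕ_; n<s[n/ℕd]*d)
open import Relation.Nullary using (yes; no; contradiction)

m≤n+o⇒+m-+n≤+o : ∀ {m n o} → m ≤ n + o → + m - + n ℤ.≤ + o
m≤n+o⇒+m-+n≤+o {m} {n} {o} m≤n+o = begin
  + m - + n          ≡⟨ ℤ.[+m]-[+n]≡m⊖n m n ⟩
  m ⊖ n              ≤⟨ ℤ.⊖-monoˡ-≤ n m≤n+o ⟩
  (n + o) ⊖ n        ≡⟨ cong ((n + o) ⊖_) (sym (+-identityʳ n)) ⟩
  (n + o) ⊖ (n + 0)  ≡⟨ ℤ.+-cancelˡ-⊖ n o 0 ⟩
  + o                ∎
  where open ℤ.≤-Reasoning

i*d≤n⇒i≤n/ℕd : ∀ {i} n d .{{_ : NonZero d}} → i ℤ.* + d ℤ.≤ n → i ℤ.≤ n /ℕ d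
i*d≤n⇒i≤n/ℕd {i} n d i*d≤n with i ℤ.≤? n /ℕ d
... | yes i≤n/d = i≤n/d
... | no  i≰n/d = contradiction (ℤ.≤-trans [1+n/d]*d≤i*d i*d≤n) (ℤ.<⇒≱ (n<s[n/ℕd]*d n d))
  where
  [1+n/d]*d≤i*d : ℤ.suc (n /ℕ d) ℤ.* + d ℤ.≤ i ℤ.* + d
  [1+n/d]*d≤i*d = ℤ.*-monoʳ-≤-nonNeg (+ d) (ℤ.i<j⇒suc[i]≤j (ℤ.≰⇒> i≰n/d))

a≤r*k⇒⌈a/k⌉≤r : ∀ a k r → a ℤ.≤ + (r * k) → ⌈ a / k ⌉ ℤ.≤ + r
a≤r*k⇒⌈a/k⌉≤r a zero    r _      = ℤ.+≤+ z≤n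
a≤r*k⇒⌈a/k⌉≤r a (suc k) r a≤r*k = begin
  - ((- a) /ℕ suc k)  ≤⟨ ℤ.neg-mono-≤ (i*d≤n⇒i≤n/ℕd (- a) (suc k) -r*k≤-a) ⟩
  - - + r             ≡⟨ ℤ.neg-involutive (+ r) ⟩
  + r                 ∎
  where
  open ℤ.≤-Reasoning
  -r*k≤-a : - + r ℤ.* + suc k ℤ.≤ - a
  -r*k≤-a = begin
    - + r ℤ.* + suc k    ≡⟨ sym (ℤ.neg-distribˡ-* (+ r) (+ suc k)) ⟩
    - (+ r ℤ.* + suc k)  ≡⟨ cong -_ (sym (ℤ.pos-* r (suc k))) ⟩
    - + (r * suc k)      ≤⟨ ℤ.neg-mono-≤ a≤r*k ⟩
    - a                  ∎

lemma3p10 : (n k p j r : ℕ) (B : Blocks n j) →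
    IsLotteryDesign n k p 2 j B → Segregated B → NumIsolated B r →
    + r ≥ ⌈ (+ (2 * n) - + (j * k)) / k ⌉
lemma3p10 n k p j r B (_ , _ , _ , _ , uniform , _) segregated isolated =
  a≤r*k⇒⌈a/k⌉≤r (+ (2 * n) - + (j * k)) k r
    (m≤n+o⇒+m-+n≤+o (2n≤jk+rk B uniform segregated isolated))
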